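{- Let $(U,\mathcal C)$ be an X3C instance and let $(G,k)$ be the MHL instance constructed from it as described in the context, with the fixed subset $B'\subseteq B$. If $L$ is a hub labeling of $G$ satisfying the cover property with $\max_{v}\max(|L_f(v)|,|L_r(v)|)\le k$, then for all $u\in U$, $B'\subseteq L_r(u)$.
   Context: An X3C instance $(U,\mathcal C)$ consists of a finite set $U$ with $|U|$ divisible by 3 and a collection $\mathcal C$ of 3-element subsets of $U$. Construction: the directed graph $G$ has vertex set $V=A\cup\mathcal C\cup U\cup B$ (disjoint), where $A=\{a_1,a_2\}$ and $|B|=\frac{2}{3}|U|+1$. Arcs: $(a,c)$ for all $a\in A$, $c\in\mathcal C$; $(c,u)$ for all $c\in\mathcal C$, $u\in U$ with $u\in c$; $(b_1,b_2)$ for all distinct $b_1,b_2\in B$; and, for a fixed subset $B'\subseteq B$ with $|B'|=\frac{|U|}{3}-1$, arcs $(b',u)$ for all $b'\in B'$, $u\in U$. All arcs have length 1. Set $k=\frac{|U|}{3}+1$. A hub labeling assigns to each vertex $v$ a forward label $L_f(v)\subseteq V$ and a reverse label $L_r(v)\subseteq V$; the cover property requires that for every ordered pair of distinct vertices $(s,t)$ with $t$ reachable from $s$, $L_f(s)\cap L_r(t)$ contains a vertex on a shortest directed $s$–$t$ path. -}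

module Defs where

open import Data.Nat using (ℕ; zero; suc; _+_; _*_; _∸_; _≤_; _<_)
open import Data.Fin using (Fin)
open import Data.Fin.Subset as FS using (Subset; ∣_∣)
open import Data.List using (List; length)
open import Data.List.Membership.Propositional as LM using ()
open import Data.List.Relation.Unary.Unique.Propositional using (Unique)
open import Data.Product using (Σ; ∃; _×_; _,_)
open import Relation.Binary.PropositionalEquality using (_≡_; _≢_)
open import Function.Definitions using (Injective)

-- An X3C instance: U = Fin (3 * m) (so |U| = 3m is divisible by 3),
-- the collection C is given by an injective family S : Fin c → Subset (3 * m)
-- of 3-element subsets (injective because C is a set of subsets).
record X3C : Set where
  field
    m      : ℕ
    c      : ℕ
    S      : Fin c → Subset (3 * m)
    S-card : ∀ j → ∣ S j ∣ ≡ 3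
    S-inj  : Injective _≡_ _≡_ S

-- The MHL construction, given the X3C instance and the fixed subset B' ⊆ B,
-- where B = Fin (2m + 1)  (|B| = (2/3)|U| + 1).
module Construction (I : X3C) (B' : Subset (suc (2 * X3C.m I))) where
  open X3C I

  nU : ℕ
  nU = 3 * m

  nB : ℕ
  nB = suc (2 * m)

  data Vertex : Set where
    aV : Fin 2 → Vertex
    cV : Fin c → Vertex
    uV : Fin nU → Vertex
    bV : Fin nB → Vertex

  data Arc : Vertex → Vertex → Set where
    a→c : ∀ i j → Arc (aV i) (cV j)
    c→u : ∀ j u → u FS.∈ S j → Arc (cV j) (uV u)
    b→b : ∀ b₁ b₂ → b₁ ≢ b₂ → Arc (bV b₁) (bV b₂)
    b'→u : ∀ b u → b FS.∈ B' → Arc (bV b) (uV u)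

  -- Directed walks with their length (= number of arcs, all arcs have length 1).
  data Walk : Vertex → Vertex → ℕ → Set where
    [] : ∀ {v} → Walk v v 0
    _∷_ : ∀ {u v w n} → Arc u v → Walk v w n → Walk u w (suc n)

  data OnWalk (x : Vertex) : ∀ {s t n} → Walk s t n → Set where
    here-nil : OnWalk x {x} {x} []
    here     : ∀ {v t n} (e : Arc x v) (p : Walk v t n) → OnWalk x (e ∷ p)
    there    : ∀ {s v t n} (e : Arc s v) {p : Walk v t n} → OnWalk x p → OnWalk x (e ∷ p)

  Reachable : Vertex → Vertex → Set
  Reachable s t = ∃ λ n → Walk s t n

  -- p is a shortest directed s–t path (a shortest walk is necessarily a path).
  IsShortest : ∀ {s t n} → Walk s t n → Set
  IsShortest {s} {t} {n} p = ∀ n' → Walk s t n' → n ≤ n'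

  OnShortestPath : Vertex → Vertex → Vertex → Set
  OnShortestPath s t x =
    Σ ℕ λ n → Σ (Walk s t n) λ p → IsShortest p × OnWalk x p

  -- A hub labeling: forward and reverse labels, each a set of vertices
  -- (duplicate-free list), so |L(v)| = length of the list.
  record HubLabeling : Set where
    field
      Lf      : Vertex → List Vertex
      Lr      : Vertex → List Vertex
      Lf-uniq : ∀ v → Unique (Lf v)
      Lr-uniq : ∀ v → Unique (Lr v)

  CoverProperty : HubLabeling → Set
  CoverProperty L = ∀ s t → s ≢ t → Reachable s t →
    Σ Vertex λ x → x LM.∈ Lf s × x LM.∈ Lr t × OnShortestPath s t x
    where open HubLabeling L

  -- k = |U|/3 + 1
  k : ℕ
  k = m + 1

  SizeBound : HubLabeling → ℕ → Set
  SizeBound L k' = ∀ v → length (Lf v) ≤ k' × length (Lr v) ≤ k'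
    where open HubLabeling L

module Submission where

-- The set B = {b₀, …, b_{2m}} (n = 2m + 1 vertices) is a complete directed
-- graph.  An arc s → t is its own unique shortest path, so its cover hub
-- is one of its endpoints: either s ∈ Lf s ∩ Lr t or t ∈ Lf s ∩ Lr t.
-- Counting the pairs (i, j) of clique vertices, this forces the labels of
-- B to contain n(n + 1) clique entries as soon as every bᵢ is its own
-- forward and reverse hub; and that in turn holds when m ≥ 2, since a bᵢ
-- missing from its own label needs all the other 2m clique vertices there,
-- more than the k = m + 1 places allow.  With label size k = m + 1 the labels of B hold at most
-- 2n(m + 1) = n(n + 1) entries, so there is no slack at all.  If b' ∉ Lr u
-- for some b' ∈ B', the arc b' → u has hub u ∈ Lf b', a non-clique entry,
-- and the count drops below n(n + 1): a contradiction.  Finally m ≥ 2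
-- because B' is nonempty and |B'| = m - 1.

open import Defs
open import Data.Nat using (ℕ; zero; suc; _+_; _*_; _∸_; _≤_; _<_; z≤n; s≤s)
open import Data.Nat.Properties
open import Data.Nat.Tactic.RingSolver using (solve-∀)
open import Data.Fin using (Fin; zero; suc)
import Data.Fin.Properties as Fin
open import Data.Fin.Subset as FS using (Subset; ∣_∣)
open import Data.Fin.Subset.Properties using (x∈p⇒∣p-x∣<∣p∣)
import Data.Vec.Functional as Vector
open import Data.List using (List; []; _∷_; length)
open import Data.List.Relation.Unary.Any using (here; there)
open import Data.List.Membership.Propositional as LM using (_∈_)
open import Data.Product using (_×_; _,_; proj₁; proj₂; swap)
open import Data.Sum using (_⊎_; inj₁; inj₂)
import Data.Sum.Properties as Sum
open import Data.Empty using (⊥-elim)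
open import Relation.Nullary using (¬_; Dec; yes; no)
open import Relation.Nullary.Decidable using (map′; decidable-stable)
open import Relation.Binary.PropositionalEquality
open import Relation.Binary.Definitions using (DecidableEquality)
open import Function using (_∘_)
open import Function.Definitions using (Injective)
open import Algebra.Properties.CommutativeMonoid.Sum +-0-commutativeMonoid
  using (sum; sum-cong-≗; ∑-distrib-+; ∑-comm)

∑-mono : ∀ {n} {f g : Fin n → ℕ} → (∀ i → f i ≤ g i) → sum f ≤ sum g
∑-mono {zero}  f≤g = z≤n
∑-mono {suc n} f≤g = +-mono-≤ (f≤g zero) (∑-mono (f≤g ∘ suc))

∑-const : ∀ n c → sum {n} (λ _ → c) ≡ n * c
∑-const zero    c = refl
∑-const (suc n) c = cong (c +_) (∑-const n c)

∑-ones : ∀ n → sum {n} (λ _ → 1) ≡ n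
∑-ones n = trans (∑-const n 1) (*-identityʳ n)

∑-vanishing : ∀ {n} {f : Fin n → ℕ} → (∀ i → f i ≡ 0) → sum f ≡ 0
∑-vanishing {zero}  f≡0 = refl
∑-vanishing {suc n} f≡0 = cong₂ _+_ (f≡0 zero) (∑-vanishing (f≡0 ∘ suc))

∑-term : ∀ {n} (f : Fin n → ℕ) i → f i ≤ sum f
∑-term f zero    = m≤m+n _ _
∑-term f (suc i) = ≤-trans (∑-term (f ∘ suc) i) (m≤n+m _ _)

∑-bounded : ∀ {n K} {f : Fin n → ℕ} → (∀ i → f i ≤ K) → sum f ≤ n * K
∑-bounded {n} {K} f≤K = ≤-trans (∑-mono f≤K) (≤-reflexive (∑-const n K))

∑-bounded-strict : ∀ {n K} {f : Fin n → ℕ} → (∀ i → f i ≤ K) →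
  ∀ i → f i < K → sum f < n * K
∑-bounded-strict f≤K zero    f₀<K = +-mono-≤ f₀<K (∑-bounded (f≤K ∘ suc))
∑-bounded-strict {f = f} f≤K (suc i) fᵢ<K =
  ≤-trans (≤-reflexive (sym (+-suc (f zero) _)))
          (+-mono-≤ (f≤K zero) (∑-bounded-strict (f≤K ∘ suc) i fᵢ<K))

𝟙 : ∀ {P : Set} → Dec P → ℕ
𝟙 (yes _) = 1
𝟙 (no _)  = 0

𝟙-yes : ∀ {P : Set} (d : Dec P) → P → 1 ≤ 𝟙 d
𝟙-yes (yes _) _ = s≤s z≤n
𝟙-yes (no ¬p) p = ⊥-elim (¬p p)

𝟙-no : ∀ {P : Set} (d : Dec P) → ¬ P → 𝟙 d ≡ 0
𝟙-no (yes p) ¬p = ⊥-elim (¬p p)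
𝟙-no (no _)  _  = refl

module Counting {V : Set} (_≟_ : DecidableEquality V) where
  open import Data.List.Membership.DecPropositional _≟_ public using (_∈?_)

  multiplicity : ∀ {n} → (Fin n → V) → V → ℕ
  multiplicity g x = sum λ j → 𝟙 (g j ≟ x)

  count : ∀ {n} → (Fin n → V) → List V → ℕ
  count g xs = sum λ j → 𝟙 (g j ∈? xs)

  multiplicity-image : ∀ {n} (g : Fin n → V) i → 1 ≤ multiplicity g (g i)
  multiplicity-image g i =
    ≤-trans (𝟙-yes (g i ≟ g i) refl) (∑-term (λ j → 𝟙 (g j ≟ g i)) i)

  multiplicity-≤1 : ∀ {n} (g : Fin n → V) → Injective _≡_ _≡_ g →
    ∀ x → multiplicity g x ≤ 1
  multiplicity-≤1 {zero}  g g-inj x = z≤n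
  multiplicity-≤1 {suc n} g g-inj x with g zero ≟ x
  ... | no _      = multiplicity-≤1 (g ∘ suc) (Fin.suc-injective ∘ g-inj) x
  ... | yes g₀≡x  = ≤-reflexive (cong suc (∑-vanishing others-miss))
    where
    others-miss : ∀ j → 𝟙 (g (suc j) ≟ x) ≡ 0
    others-miss j = 𝟙-no (g (suc j) ≟ x)
      λ gⱼ≡x → Fin.0≢1+n (g-inj (trans g₀≡x (sym gⱼ≡x)))

  count-≤-length : ∀ {n} (g : Fin n → V) → Injective _≡_ _≡_ g →
    ∀ xs → count g xs ≤ length xs
  count-≤-length g g-inj [] =
    ≤-reflexive (∑-vanishing λ j → 𝟙-no (g j ∈? []) λ ())
  count-≤-length g g-inj (x ∷ xs) = begin
    count g (x ∷ xs)                    ≤⟨ ∑-mono (split ∘ g) ⟩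
    sum (λ j → 𝟙 (g j ≟ x) + 𝟙 (g j ∈? xs))
                                        ≡⟨ ∑-distrib-+ (λ j → 𝟙 (g j ≟ x)) (λ j → 𝟙 (g j ∈? xs)) ⟩
    multiplicity g x + count g xs       ≤⟨ +-mono-≤ (multiplicity-≤1 g g-inj x)
                                                    (count-≤-length g g-inj xs) ⟩
    suc (length xs)                     ∎
    where
    open ≤-Reasoning
    split : ∀ y → 𝟙 (y ∈? x ∷ xs) ≤ 𝟙 (y ≟ x) + 𝟙 (y ∈? xs)
    split y with y ∈? x ∷ xs
    ... | no _             = z≤n
    ... | yes (here y≡x)   = ≤-trans (𝟙-yes (y ≟ x) y≡x) (m≤m+n _ _)
    ... | yes (there y∈xs) = ≤-trans (𝟙-yes (y ∈? xs) y∈xs) (m≤n+m _ _)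

  count-<-length : ∀ {n} (g : Fin n → V) → Injective _≡_ _≡_ g →
    ∀ {x xs} → x ∈ xs → (∀ j → g j ≢ x) → count g xs < length xs
  count-<-length g g-inj {x} {xs} x∈xs outside =
    ≤-trans (+-monoˡ-≤ (count g xs) (𝟙-yes (x ∈? xs) x∈xs))
            (count-≤-length (x Vector.∷ g) extended-inj xs)
    where
    extended-inj : Injective _≡_ _≡_ (x Vector.∷ g)
    extended-inj {zero}  {zero}  _     = refl
    extended-inj {zero}  {suc j} x≡gⱼ  = ⊥-elim (outside j (sym x≡gⱼ))
    extended-inj {suc i} {zero}  gᵢ≡x  = ⊥-elim (outside i gᵢ≡x)
    extended-inj {suc i} {suc j} gᵢ≡gⱼ = cong suc (g-inj gᵢ≡gⱼ)

EndpointHub : {V : Set} → (V → List V) → (V → List V) → V → V → Set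
EndpointHub Lf Lr s t = (s ∈ Lf s × s ∈ Lr t) ⊎ (t ∈ Lf s × t ∈ Lr t)

EndpointHub-reverse : ∀ {V : Set} {Lf Lr : V → List V} {s t} →
  EndpointHub Lf Lr s t → EndpointHub Lr Lf t s
EndpointHub-reverse (inj₁ s-hub) = inj₂ (swap s-hub)
EndpointHub-reverse (inj₂ t-hub) = inj₁ (swap t-hub)

module Clique {V : Set} (_≟_ : DecidableEquality V) (Lf Lr : V → List V)
  {n : ℕ} (b : Fin n → V) (b-inj : Injective _≡_ _≡_ b)
  (clique-hub : ∀ i j → i ≢ j → EndpointHub Lf Lr (b i) (b j)) where
  open Counting _≟_

  forward reverse : Fin n → Fin n → ℕ
  forward i j = 𝟙 (b j ∈? Lf (b i))
  reverse i j = 𝟙 (b i ∈? Lr (b j))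

  missing-self-hub : ∀ i → ¬ b i ∈ Lf (b i) → n ≤ suc (count b (Lf (b i)))
  missing-self-hub i bᵢ∉Lf = begin
    n                                        ≡⟨ ∑-ones n ⟨
    sum {n} (λ _ → 1)                        ≤⟨ ∑-mono forward-or-self ⟩
    sum (λ j → forward i j + 𝟙 (b j ≟ b i))
                                             ≡⟨ ∑-distrib-+ (forward i) (λ j → 𝟙 (b j ≟ b i)) ⟩
    count b (Lf (b i)) + multiplicity b (b i)
                                             ≤⟨ +-monoʳ-≤ _ (multiplicity-≤1 b b-inj (b i)) ⟩
    count b (Lf (b i)) + 1                   ≡⟨ +-comm _ 1 ⟩
    suc (count b (Lf (b i)))                 ∎
    where
    open ≤-Reasoning
    forward-or-self : ∀ j → 1 ≤ forward i j + 𝟙 (b j ≟ b i)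
    forward-or-self j with b j ≟ b i
    ... | yes _     = m≤n+m 1 _
    ... | no bⱼ≢bᵢ  with clique-hub i j (λ { refl → bⱼ≢bᵢ refl })
    ...   | inj₁ (bᵢ∈Lf , _) = ⊥-elim (bᵢ∉Lf bᵢ∈Lf)
    ...   | inj₂ (bⱼ∈Lf , _) = ≤-trans (𝟙-yes (b j ∈? Lf (b i)) bⱼ∈Lf) (m≤m+n _ _)

  -- Each ordered pair is served once, the diagonal twice.
  pair-served : (∀ i → b i ∈ Lf (b i) × b i ∈ Lr (b i)) →
    ∀ i j → 1 + 𝟙 (b j ≟ b i) ≤ forward i j + reverse i j
  pair-served self i j with b j ≟ b i
  ... | yes bⱼ≡bᵢ with b-inj bⱼ≡bᵢ
  ...   | refl = +-mono-≤ (𝟙-yes (b i ∈? Lf (b i)) (proj₁ (self i)))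
                          (𝟙-yes (b i ∈? Lr (b i)) (proj₂ (self i)))
  pair-served self i j | no bⱼ≢bᵢ with clique-hub i j (λ { refl → bⱼ≢bᵢ refl })
  ...   | inj₁ (_ , bᵢ∈Lr) = ≤-trans (𝟙-yes (b i ∈? Lr (b j)) bᵢ∈Lr) (m≤n+m _ _)
  ...   | inj₂ (bⱼ∈Lf , _) = ≤-trans (𝟙-yes (b j ∈? Lf (b i)) bⱼ∈Lf) (m≤m+n _ _)

  clique-label-total : (∀ i → b i ∈ Lf (b i) × b i ∈ Lr (b i)) →
    n * suc n ≤ sum (λ i → count b (Lf (b i))) + sum (λ j → count b (Lr (b j)))
  clique-label-total self = begin
    n * suc n                                ≡⟨ ∑-const n (suc n) ⟨
    sum {n} (λ _ → suc n)                    ≤⟨ ∑-mono row ⟩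
    sum (λ i → sum (λ j → forward i j + reverse i j))
                                             ≡⟨ sum-cong-≗ (λ i → ∑-distrib-+ (forward i) (reverse i)) ⟩
    sum (λ i → count b (Lf (b i)) + sum (reverse i))
                                             ≡⟨ ∑-distrib-+ (λ i → count b (Lf (b i))) (λ i → sum (reverse i)) ⟩
    sum (λ i → count b (Lf (b i))) + sum (λ i → sum (reverse i))
                                             ≡⟨ cong (_ +_) (∑-comm reverse) ⟩
    sum (λ i → count b (Lf (b i))) + sum (λ j → count b (Lr (b j))) ∎
    where
    open ≤-Reasoning
    row : ∀ i → suc n ≤ sum (λ j → forward i j + reverse i j)
    row i = begin
      suc n                                  ≡⟨ +-comm 1 n ⟩
      n + 1                                  ≡⟨ cong (_+ 1) (∑-ones n) ⟨
      sum {n} (λ _ → 1) + 1                  ≤⟨ +-monoʳ-≤ _ (multiplicity-image b i) ⟩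
      sum {n} (λ _ → 1) + multiplicity b (b i)
                                             ≡⟨ ∑-distrib-+ (λ _ → 1) (λ j → 𝟙 (b j ≟ b i)) ⟨
      sum (λ j → 1 + 𝟙 (b j ≟ b i))          ≤⟨ ∑-mono (pair-served self i) ⟩
      sum (λ j → forward i j + reverse i j)  ∎

clique-exceeds-label : ∀ {m} → 2 ≤ m → ¬ suc (2 * m) ≤ suc (m + 1)
clique-exceeds-label {m} m≥2 n≤k+1 = <⇒≱ m≥2 m≤1
  where
  m≤1 : m ≤ 1
  m≤1 = subst (_≤ 1) (+-identityʳ m) (+-cancelˡ-≤ m (m + 0) 1 (≤-pred n≤k+1))

two-labels-per-vertex : ∀ m →
  suc (2 * m) * (m + 1) + suc (2 * m) * (m + 1) ≡ suc (2 * m) * suc (suc (2 * m))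
two-labels-per-vertex = solve-∀

module _ (I : X3C) (B' : Subset (suc (2 * X3C.m I))) where
  open X3C I
  open Construction I B'

  -- Vertices are coded injectively into a disjoint union of finite sets,
  -- which gives decidable equality of vertices (needed for counting).
  VertexCode : Set
  VertexCode = Fin 2 ⊎ Fin c ⊎ Fin nU ⊎ Fin nB

  encode : Vertex → VertexCode
  encode (aV i) = inj₁ i
  encode (cV j) = inj₂ (inj₁ j)
  encode (uV u) = inj₂ (inj₂ (inj₁ u))
  encode (bV b) = inj₂ (inj₂ (inj₂ b))

  decode : VertexCode → Vertex
  decode (inj₁ i)                  = aV i
  decode (inj₂ (inj₁ j))           = cV j
  decode (inj₂ (inj₂ (inj₁ u)))    = uV u
  decode (inj₂ (inj₂ (inj₂ b)))    = bV b

  decode-encode : ∀ v → decode (encode v) ≡ v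
  decode-encode (aV _) = refl
  decode-encode (cV _) = refl
  decode-encode (uV _) = refl
  decode-encode (bV _) = refl

  _≟V_ : DecidableEquality Vertex
  v ≟V w = map′ encode-injective (cong encode) (encode v ≟code encode w)
    where
    _≟code_ : DecidableEquality VertexCode
    _≟code_ = Sum.≡-dec Fin._≟_ (Sum.≡-dec Fin._≟_ (Sum.≡-dec Fin._≟_ Fin._≟_))
    encode-injective : encode v ≡ encode w → v ≡ w
    encode-injective e =
      trans (sym (decode-encode v)) (trans (cong decode e) (decode-encode w))

  bV-injective : Injective _≡_ _≡_ bV
  bV-injective refl = refl

  arc-shortest-endpoints : ∀ {s t x} → Arc s t → OnShortestPath s t x → x ≡ s ⊎ x ≡ t
  arc-shortest-endpoints _ (zero , [] , _ , here-nil) = inj₁ refl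
  arc-shortest-endpoints _ (suc zero , _ ∷ [] , _ , here _ _) = inj₁ refl
  arc-shortest-endpoints _ (suc zero , _ ∷ [] , _ , there _ here-nil) = inj₂ refl
  arc-shortest-endpoints e (suc (suc _) , _ ∷ _ ∷ _ , shortest , _)
    with shortest 1 (e ∷ [])
  ... | s≤s ()

  module _ (L : HubLabeling) (cover : CoverProperty L) where
    open HubLabeling L

    arc-hub : ∀ {s t} → s ≢ t → Arc s t → EndpointHub Lf Lr s t
    arc-hub {s} {t} s≢t e with cover s t s≢t (1 , e ∷ [])
    ... | x , x∈Lf , x∈Lr , on-path with arc-shortest-endpoints e on-path
    ...   | inj₁ refl = inj₁ (x∈Lf , x∈Lr)
    ...   | inj₂ refl = inj₂ (x∈Lf , x∈Lr)

    clique-hub : ∀ i j → i ≢ j → EndpointHub Lf Lr (bV i) (bV j)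
    clique-hub i j i≢j = arc-hub (i≢j ∘ bV-injective) (b→b i j i≢j)

    open Counting _≟V_
    open Clique _≟V_ Lf Lr bV bV-injective clique-hub
    module Reversed = Clique _≟V_ Lr Lf bV bV-injective
      (λ i j i≢j → EndpointHub-reverse {Lf = Lf} {Lr} (clique-hub j i (i≢j ∘ sym)))

    module _ (size : SizeBound L k) where

      label-count : ∀ v → count bV (Lf v) ≤ k × count bV (Lr v) ≤ k
      label-count v =
        ≤-trans (count-≤-length bV bV-injective (Lf v)) (proj₁ (size v)) ,
        ≤-trans (count-≤-length bV bV-injective (Lr v)) (proj₂ (size v))

      self-hubs : 2 ≤ m → ∀ i → bV i ∈ Lf (bV i) × bV i ∈ Lr (bV i)
      self-hubs m≥2 i =
        self-hub (missing-self-hub i) (proj₁ (label-count (bV i))) ,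
        self-hub (Reversed.missing-self-hub i) (proj₂ (label-count (bV i)))
        where
        self-hub : ∀ {xs} → (¬ bV i ∈ xs → nB ≤ suc (count bV xs)) →
          count bV xs ≤ k → bV i ∈ xs
        self-hub {xs} forced bounded = decidable-stable (bV i ∈? xs)
          λ bᵢ∉xs → clique-exceeds-label m≥2 (≤-trans (forced bᵢ∉xs) (s≤s bounded))

      -- A vertex of B' missing from Lr u leaves the labels of B too small.
      B'-reverse-hub : 2 ≤ m → ∀ u b → b FS.∈ B' → bV b ∈ Lr (uV u)
      B'-reverse-hub m≥2 u b b∈B' = decidable-stable (bV b ∈? Lr (uV u)) λ b∉Lr →
        <⇒≱ (labels-too-small b∉Lr) (clique-label-total (self-hubs m≥2))
        where
        labels-too-small : ¬ bV b ∈ Lr (uV u) →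
          sum (λ i → count bV (Lf (bV i))) + sum (λ j → count bV (Lr (bV j)))
            < nB * suc nB
        labels-too-small b∉Lr = <-≤-trans
          (+-mono-<-≤ (∑-bounded-strict (proj₁ ∘ label-count ∘ bV) b forward-short)
                      (∑-bounded (proj₂ ∘ label-count ∘ bV)))
          (≤-reflexive (two-labels-per-vertex m))
          where
          u∈Lf : uV u ∈ Lf (bV b)
          u∈Lf with arc-hub (λ ()) (b'→u b u b∈B')
          ... | inj₁ (_ , b∈Lr) = ⊥-elim (b∉Lr b∈Lr)
          ... | inj₂ (u∈Lf , _) = u∈Lf
          forward-short : count bV (Lf (bV b)) < k
          forward-short = <-≤-trans (count-<-length bV bV-injective u∈Lf λ _ ())
                                    (proj₁ (size (bV b)))

corollary1 : (I : X3C) (B' : Subset (suc (2 * X3C.m I))) →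
    ∣ B' ∣ ≡ X3C.m I ∸ 1 →
    (L : Construction.HubLabeling I B') →
    Construction.CoverProperty I B' L →
    Construction.SizeBound I B' L (Construction.k I B') →
    ∀ (u : Fin (3 * X3C.m I)) (b : Fin (suc (2 * X3C.m I))) → b FS.∈ B' →
    Construction.bV b LM.∈ Construction.HubLabeling.Lr L (Construction.uV u)
corollary1 I B' ∣B'∣≡m∸1 L cover size u b b∈B' =
  B'-reverse-hub I B' L cover size m≥2 u b b∈B'
  where
  -- B' is nonempty, so m ∸ 1 > 0.
  m≥2 : 2 ≤ X3C.m I
  m≥2 = m∸n≢0⇒n<m (n>0⇒n≢0 (subst (0 <_) ∣B'∣≡m∸1 B'-nonempty))
    where
    B'-nonempty : 0 < ∣ B' ∣
    B'-nonempty = ≤-<-trans z≤n (x∈p⇒∣p-x∣<∣p∣ b∈B')
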